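{- Let $F$ be a finite, simple, undirected, connected graph with $|V(F)|\ge 3$ and diameter at most $2$, let $c$ be a positive integer, and let $G$ be the graph obtained from $F$ and $c$ as described in the context. If $F$ has a vertex cover $VC$ with $|VC|\le k$ for some positive integer $k$, then $G$ has a monitoring edge-geodetic set $M$ with $|M|\le ck+|V(F)|+1$.
   Context: An edge $\{a,b\}$ of a graph $G$ is monitored by a pair of vertices $\{x,y\}$ if $\{a,b\}$ lies on every shortest path from $x$ to $y$ in $G$. A monitoring edge-geodetic set (MEG-set) of $G$ is a set $M\subseteq V(G)$ such that every edge of $G$ is monitored by some pair $\{x,y\}$ with $x,y\in M$. Construction of $G$: take $c$ disjoint copies $F_1,\dots,F_c$ of $F$, where $V(F_i)=\{v_i : v\in V(F)\}$ and $E(F_i)=\{\{u_i,v_i\}:\{u,v\}\in E(F)\}$. For each $v\in V(F)$ add two new vertices $v'$ and $v''$, the edge $\{v',v''\}$, and the edges $\{v_i,v'\}$ for all $1\le i\le c$; let $L'=\{v':v\in V(F)\}$ and $L''=\{v'':v\in V(F)\}$. Finally add two new vertices $v_*$ and $v_*'$, the edge $\{v_*,v_*'\}$, and the edges $\{v_*,v'\}$ for all $v'\in L'$. -}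

module Defs where

open import Data.Nat using (ℕ; zero; suc; _≤_; _*_; _+_)
open import Data.Fin using (Fin)
open import Data.Bool using (Bool; true; false; T)
open import Data.Product using (Σ; ∃; _×_; _,_)
open import Data.List using (List)
open import Data.List.Membership.Propositional using (_∈_)
open import Relation.Binary.PropositionalEquality using (_≡_)

data Walk {V : Set} (E : V → V → Set) : V → V → ℕ → Set where
  []  : ∀ {x} → Walk E x x 0
  _∷_ : ∀ {x y z n} → E x y → Walk E y z n → Walk E x z (suc n)

data OnWalk {V : Set} {E : V → V → Set} (a b : V)
     : ∀ {x y n} → Walk E x y n → Set where
  here-fwd : ∀ {z n} (e : E a b) (w : Walk E b z n) → OnWalk a b (e ∷ w)
  here-bwd : ∀ {z n} (e : E b a) (w : Walk E a z n) → OnWalk a b (e ∷ w)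
  there    : ∀ {x y z n} (e : E x y) {w : Walk E y z n}
           → OnWalk a b w → OnWalk a b (e ∷ w)

IsShortest : {V : Set} {E : V → V → Set} {x y : V} {n : ℕ} → Walk E x y n → Set
IsShortest {E = E} {x} {y} {n} _ = ∀ m → Walk E x y m → n ≤ m

Monitors : {V : Set} (E : V → V → Set) (x y a b : V) → Set
Monitors E x y a b = ∀ n (w : Walk E x y n) → IsShortest w → OnWalk a b w

IsMEG : {V : Set} (E : V → V → Set) (M : List V) → Set
IsMEG E M = ∀ a b → E a b → Σ _ λ x → Σ _ λ y → x ∈ M × y ∈ M × Monitors E x y a b

AdjF : {n : ℕ} → (Fin n → Fin n → Bool) → Fin n → Fin n → Set
AdjF adj u v = T (adj u v)

IsVertexCover : {n : ℕ} (adj : Fin n → Fin n → Bool) (VC : List (Fin n)) → Set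
IsVertexCover adj VC = ∀ u v → T (adj u v) → (u ∈ VC) Data.Sum.⊎ (v ∈ VC)
  where import Data.Sum

data GV (n c : ℕ) : Set where
  copy   : Fin c → Fin n → GV n c
  prime  : Fin n → GV n c
  dprime : Fin n → GV n c
  star   : GV n c
  star'  : GV n c

data GAdj {n c : ℕ} (adj : Fin n → Fin n → Bool) : GV n c → GV n c → Set where
  copy-copy     : ∀ i u v → T (adj u v) → GAdj adj (copy i u) (copy i v)
  copy-prime    : ∀ i v → GAdj adj (copy i v) (prime v)
  prime-copy    : ∀ i v → GAdj adj (prime v) (copy i v)
  prime-dprime  : ∀ v → GAdj adj (prime v) (dprime v)
  dprime-prime  : ∀ v → GAdj adj (dprime v) (prime v)
  star-prime    : ∀ v → GAdj adj star (prime v)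
  prime-star    : ∀ v → GAdj adj (prime v) star
  star-star'    : GAdj adj star star'
  star'-star    : GAdj adj star' star

-- Put into M the vertex v_*', every v'', and every copy u_i of a vertex u of
-- the cover.  The pendant path v'' v' v_* v_*' is the unique geodesic between
-- v'' and v_*', so it monitors the edges near v_* and v''.  An edge u_i v_i with
-- u in the cover lies on the unique geodesic u_i v_i v' v'' (u ≠ v since F has
-- no loops), and the same geodesic monitors v_i v'; if v itself is in the cover,
-- the geodesic v_i v' v'' monitors v_i v'.  Vertices of F outside the cover have
-- a neighbour in it because F is connected with at least two vertices.
module Submission where

open import Defs
open import Data.Nat using (ℕ; suc; _≤_; _*_; _+_; s≤s)
open import Data.Nat.Properties using (+-comm; +-monoˡ-≤; *-monoʳ-≤; ≤-trans)
open import Data.Fin using (Fin; zero; suc)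
open import Data.Fin.Properties using (_≟_)
open import Data.Bool using (Bool; false; T)
open import Data.Product using (Σ; _×_; _,_; proj₁; proj₂)
open import Data.Sum using (inj₁; inj₂)
open import Data.Empty using (⊥-elim)
open import Data.List using (List; []; _∷_; length; map; _++_; allFin; cartesianProductWith; deduplicate)
open import Data.List.Properties using (length-map; length-++; length-tabulate; length-deduplicate)
open import Data.List.Relation.Unary.Unique.Propositional using (Unique)
import Data.List.Relation.Unary.AllPairs as AllPairs
open import Data.List.Relation.Unary.Unique.Propositional.Properties using (map⁺; ++⁺; cartesianProductWith⁺; allFin⁺)
open import Data.List.Relation.Unary.Unique.DecPropositional.Properties using (deduplicate-!)
import Data.List.Relation.Unary.All as All
open import Data.List.Relation.Unary.Any using (here; there)
open import Data.List.Membership.Propositional using (_∈_)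
open import Data.List.Membership.Propositional.Properties
  using (∈-map⁺; ∈-map⁻; ∈-++⁺ˡ; ∈-++⁺ʳ; ∈-++⁻; ∈-cartesianProductWith⁺; ∈-cartesianProductWith⁻; ∈-allFin; ∈-deduplicate⁺)
import Data.List.Membership.DecPropositional as DecMembership
open import Relation.Nullary using (yes; no; ¬_)
open import Relation.Binary.PropositionalEquality using (_≡_; _≢_; refl; sym; trans; cong; cong₂; subst; module ≡-Reasoning)

module _ {V : Set} {E : V → V → Set} where

  OnWalk-sym : ∀ {a b x y m} {w : Walk E x y m} → OnWalk a b w → OnWalk b a w
  OnWalk-sym (here-fwd e w) = here-bwd e w
  OnWalk-sym (here-bwd e w) = here-fwd e w
  OnWalk-sym (there e p)    = there e (OnWalk-sym p)

  monitors-of-short-walks : ∀ {x y a b m₀} → Walk E x y m₀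
    → (∀ {m} (w : Walk E x y m) → m ≤ m₀ → OnWalk a b w) → Monitors E x y a b
  monitors-of-short-walks w₀ onShort m w shortest = onShort w (shortest _ w₀)

  MonitoredIn : List V → V → V → Set
  MonitoredIn M a b = Σ V λ x → Σ V λ y → x ∈ M × y ∈ M × Monitors E x y a b

  MonitoredIn-sym : ∀ {M a b} → MonitoredIn M a b → MonitoredIn M b a
  MonitoredIn-sym (x , y , x∈ , y∈ , mon) = x , y , x∈ , y∈ , λ m w sh → OnWalk-sym (mon m w sh)

  neighbour-of-walk : ∀ {u v m} → u ≢ v → Walk E u v m → Σ V (E u)
  neighbour-of-walk u≢v []      = ⊥-elim (u≢v refl)
  neighbour-of-walk u≢v (e ∷ _) = _ , e

neighbour-of-connected : ∀ {n} {E : Fin (suc (suc n)) → Fin (suc (suc n)) → Set}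
  → (∀ u v → Σ ℕ λ m → Walk E u v m) → ∀ v → Σ (Fin (suc (suc n))) (E v)
neighbour-of-connected conn zero    = neighbour-of-walk (λ ()) (proj₂ (conn zero (suc zero)))
neighbour-of-connected conn (suc v) = neighbour-of-walk (λ ()) (proj₂ (conn (suc v) zero))

module Geodesics {n c : ℕ} (adj : Fin n → Fin n → Bool) where

  private
    G : GV n c → GV n c → Set
    G = GAdj {n} {c} adj

  pendant-walk : ∀ v → Walk G (dprime v) star' 3
  pendant-walk v = dprime-prime v ∷ prime-star v ∷ star-star' ∷ []

  short-pendant-walk-edges : ∀ {v m} (w : Walk G (dprime v) star' m) → m ≤ 3
    → OnWalk (dprime v) (prime v) w × OnWalk (prime v) star w × OnWalk star star' w
  short-pendant-walk-edges (dprime-prime v ∷ prime-star .v ∷ star-star' ∷ []) _ =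
    here-fwd _ _ , there _ (here-fwd _ _) , there _ (there _ (here-fwd _ _))
  short-pendant-walk-edges (_ ∷ _ ∷ _ ∷ _ ∷ _) (s≤s (s≤s (s≤s ())))

  copy-walk : ∀ i v → Walk G (copy i v) (dprime v) 2
  copy-walk i v = copy-prime i v ∷ prime-dprime v ∷ []

  short-copy-walk-edge : ∀ {i v m} (w : Walk G (copy i v) (dprime v) m) → m ≤ 2
    → OnWalk (copy i v) (prime v) w
  short-copy-walk-edge (copy-prime i v ∷ prime-dprime .v ∷ []) _ = here-fwd _ _
  short-copy-walk-edge (_ ∷ _ ∷ _ ∷ _) (s≤s (s≤s ()))

  edge-walk : ∀ i u v → T (adj u v) → Walk G (copy i u) (dprime v) 3
  edge-walk i u v uv = copy-copy i u v uv ∷ copy-prime i v ∷ prime-dprime v ∷ []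

  short-edge-walk-edges : (∀ x → adj x x ≡ false)
    → ∀ {i u v m} (w : Walk G (copy i u) (dprime v) m) → T (adj u v) → m ≤ 3
    → OnWalk (copy i u) (copy i v) w × OnWalk (copy i v) (prime v) w
  short-edge-walk-edges _ (copy-copy i u v _ ∷ copy-prime .i .v ∷ prime-dprime .v ∷ []) _ _ =
    here-fwd _ _ , there _ (here-fwd _ _)
  short-edge-walk-edges irrefl (copy-prime i u ∷ prime-dprime .u ∷ []) uu _ =
    ⊥-elim (subst T (irrefl u) uu)
  short-edge-walk-edges _ (_ ∷ _ ∷ _ ∷ _ ∷ _) _ (s≤s (s≤s (s≤s ())))

module Monitoring {n c : ℕ} (adj : Fin n → Fin n → Bool)
  (irrefl : ∀ x → adj x x ≡ false) (sym-adj : ∀ x y → adj x y ≡ adj y x)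
  (VC : List (Fin n)) (cover : IsVertexCover adj VC)
  (v₀ : Fin n) (neighbour : ∀ v → Σ (Fin n) λ u → T (adj v u))
  (M : List (GV n c)) (star'∈ : star' ∈ M) (dprime∈ : ∀ v → dprime v ∈ M)
  (copy∈ : ∀ i u → u ∈ VC → copy i u ∈ M) where

  open Geodesics {n} {c} adj

  private
    G : GV n c → GV n c → Set
    G = GAdj {n} {c} adj

  pendant-monitored : ∀ v → MonitoredIn M (dprime v) (prime v)
    × MonitoredIn M (prime v) star × MonitoredIn M star star'
  pendant-monitored v =
    monitoredBy (λ w le → proj₁ (short-pendant-walk-edges w le)) ,
    monitoredBy (λ w le → proj₁ (proj₂ (short-pendant-walk-edges w le))) ,
    monitoredBy (λ w le → proj₂ (proj₂ (short-pendant-walk-edges w le)))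
    where
    monitoredBy : ∀ {a b} → (∀ {m} (w : Walk G (dprime v) star' m) → m ≤ 3 → OnWalk a b w)
      → MonitoredIn M a b
    monitoredBy onShort =
      dprime v , star' , dprime∈ v , star'∈ , monitors-of-short-walks (pendant-walk v) onShort

  edge-monitored : ∀ i u v → T (adj u v) → u ∈ VC
    → MonitoredIn M (copy i u) (copy i v) × MonitoredIn M (copy i v) (prime v)
  edge-monitored i u v uv u∈ =
    monitoredBy (λ w le → proj₁ (short-edge-walk-edges irrefl w uv le)) ,
    monitoredBy (λ w le → proj₂ (short-edge-walk-edges irrefl w uv le))
    where
    monitoredBy : ∀ {a b} → (∀ {m} (w : Walk G (copy i u) (dprime v) m) → m ≤ 3 → OnWalk a b w)
      → MonitoredIn M a b
    monitoredBy onShort =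
      copy i u , dprime v , copy∈ i u u∈ , dprime∈ v , monitors-of-short-walks (edge-walk i u v uv) onShort

  private
    adj-sym : ∀ {x y} → T (adj x y) → T (adj y x)
    adj-sym {x} {y} = subst T (sym-adj x y)

  copy-prime-monitored : ∀ i v → MonitoredIn M (copy i v) (prime v)
  copy-prime-monitored i v with DecMembership._∈?_ _≟_ v VC
  ... | yes v∈ = copy i v , dprime v , copy∈ i v v∈ , dprime∈ v ,
                 monitors-of-short-walks (copy-walk i v) short-copy-walk-edge
  ... | no v∉ with neighbour v
  ... | u , vu with cover v u vu
  ... | inj₁ v∈ = ⊥-elim (v∉ v∈)
  ... | inj₂ u∈ = proj₂ (edge-monitored i u v (adj-sym vu) u∈)

  isMEG : IsMEG G M
  isMEG _ _ (copy-copy i u v uv) with cover u v uv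
  ... | inj₁ u∈ = proj₁ (edge-monitored i u v uv u∈)
  ... | inj₂ v∈ = MonitoredIn-sym (proj₁ (edge-monitored i v u (adj-sym uv) v∈))
  isMEG _ _ (copy-prime i v)   = copy-prime-monitored i v
  isMEG _ _ (prime-copy i v)   = MonitoredIn-sym (copy-prime-monitored i v)
  isMEG _ _ (prime-dprime v)   = MonitoredIn-sym (proj₁ (pendant-monitored v))
  isMEG _ _ (dprime-prime v)   = proj₁ (pendant-monitored v)
  isMEG _ _ (star-prime v)     = MonitoredIn-sym (proj₁ (proj₂ (pendant-monitored v)))
  isMEG _ _ (prime-star v)     = proj₁ (proj₂ (pendant-monitored v))
  isMEG _ _ star-star'         = proj₂ (proj₂ (pendant-monitored v₀))
  isMEG _ _ star'-star         = MonitoredIn-sym (proj₂ (proj₂ (pendant-monitored v₀)))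

length-cartesianProductWith : ∀ {A B C : Set} (f : A → B → C) xs ys
  → length (cartesianProductWith f xs ys) ≡ length xs * length ys
length-cartesianProductWith f []       ys = refl
length-cartesianProductWith f (x ∷ xs) ys = begin
  length (map (f x) ys ++ cartesianProductWith f xs ys)
    ≡⟨ length-++ (map (f x) ys) ⟩
  length (map (f x) ys) + length (cartesianProductWith f xs ys)
    ≡⟨ cong₂ _+_ (length-map (f x) ys) (length-cartesianProductWith f xs ys) ⟩
  length ys + length xs * length ys
    ∎
  where open ≡-Reasoning

length-allFin : ∀ n → length (allFin n) ≡ n
length-allFin n = length-tabulate {n = n} (λ i → i)

module WitnessSet {n c : ℕ} (VC : List (Fin n)) where

  cover-copies : List (GV n c)
  cover-copies = cartesianProductWith copy (allFin c) (deduplicate _≟_ VC)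

  dprimes : List (GV n c)
  dprimes = map dprime (allFin n)

  witnessSet : List (GV n c)
  witnessSet = star' ∷ dprimes ++ cover-copies

  star'∈witnessSet : star' ∈ witnessSet
  star'∈witnessSet = here refl

  dprime∈witnessSet : ∀ v → dprime v ∈ witnessSet
  dprime∈witnessSet v = there (∈-++⁺ˡ (∈-map⁺ dprime (∈-allFin v)))

  copy∈witnessSet : ∀ i u → u ∈ VC → copy i u ∈ witnessSet
  copy∈witnessSet i u u∈ =
    there (∈-++⁺ʳ dprimes (∈-cartesianProductWith⁺ copy (∈-allFin i) (∈-deduplicate⁺ _≟_ u∈)))

  private
    dprime-injective : ∀ {x y : Fin n} → dprime {n} {c} x ≡ dprime y → x ≡ y
    dprime-injective refl = refl

    copy-injective : ∀ {i j : Fin c} {u v : Fin n} → copy i u ≡ copy j v → i ≡ j × u ≡ v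
    copy-injective refl = refl , refl

    ∈-dprimes⁻ : ∀ {x} → x ∈ dprimes → Σ (Fin n) λ v → x ≡ dprime v
    ∈-dprimes⁻ x∈ with v , _ , x≡ ← ∈-map⁻ dprime x∈ = v , x≡

    ∈-cover-copies⁻ : ∀ {x} → x ∈ cover-copies → Σ (Fin c) λ i → Σ (Fin n) λ u → x ≡ copy i u
    ∈-cover-copies⁻ x∈ with i , u , _ , _ , x≡ ← ∈-cartesianProductWith⁻ copy (allFin c) _ x∈ = i , u , x≡

    star'∉ : ∀ {x} → x ∈ dprimes ++ cover-copies → star' ≢ x
    star'∉ x∈ refl with ∈-++⁻ dprimes x∈
    ... | inj₁ x∈d with ∈-dprimes⁻ x∈d
    ...   | _ , ()
    star'∉ x∈ refl | inj₂ x∈c with ∈-cover-copies⁻ x∈c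
    ...   | _ , _ , ()

    dprimes-disjoint : ∀ {x} → ¬ (x ∈ dprimes × x ∈ cover-copies)
    dprimes-disjoint (x∈d , x∈c) with ∈-dprimes⁻ x∈d | ∈-cover-copies⁻ x∈c
    ... | _ , refl | _ , _ , ()

  witnessSet-unique : Unique witnessSet
  witnessSet-unique = All.tabulate star'∉ AllPairs.∷ ++⁺ (map⁺ dprime-injective (allFin⁺ n))
    (cartesianProductWith⁺ copy copy-injective (allFin⁺ c) (deduplicate-! _≟_ VC)) dprimes-disjoint

  length-witnessSet : length witnessSet ≡ c * length (deduplicate _≟_ VC) + n + 1
  length-witnessSet = begin
    suc (length (dprimes ++ cover-copies))
      ≡⟨ cong suc (length-++ dprimes) ⟩
    suc (length dprimes + length cover-copies)
      ≡⟨ cong suc (cong₂ _+_ (trans (length-map dprime (allFin n)) (length-allFin n))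
                             (length-cartesianProductWith copy (allFin c) _)) ⟩
    suc (n + length (allFin c) * length (deduplicate _≟_ VC))
      ≡⟨ cong (λ m → suc (n + m * length (deduplicate _≟_ VC))) (length-allFin c) ⟩
    suc (n + c * length (deduplicate _≟_ VC))
      ≡⟨ +-comm 1 _ ⟩
    n + c * length (deduplicate _≟_ VC) + 1
      ≡⟨ cong (_+ 1) (+-comm n _) ⟩
    c * length (deduplicate _≟_ VC) + n + 1
      ∎
    where open ≡-Reasoning

lemma5 : (n : ℕ) (adj : Fin n → Fin n → Bool)
    → (∀ u → adj u u ≡ false)
    → (∀ u v → adj u v ≡ adj v u)
    → 3 ≤ n
    → (∀ u v → Σ ℕ λ m → Walk (AdjF adj) u v m)
    → (∀ u v → Σ ℕ λ m → m ≤ 2 × Walk (AdjF adj) u v m)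
    → (c k : ℕ) → 1 ≤ c → 1 ≤ k
    → (VC : List (Fin n)) → IsVertexCover adj VC → length VC ≤ k
    → Σ (List (GV n c)) λ M → Unique M × IsMEG (GAdj {n} {c} adj) M
    × length M ≤ c * k + n + 1
lemma5 n@(suc (suc _)) adj irrefl sym-adj (s≤s (s≤s _)) conn _ c k _ _ VC cover |VC|≤k =
  witnessSet , witnessSet-unique , isMEG , size-bound
  where
  open WitnessSet {n} {c} VC
  open Monitoring {n} {c} adj irrefl sym-adj VC cover zero (neighbour-of-connected conn)
    witnessSet star'∈witnessSet dprime∈witnessSet copy∈witnessSet

  size-bound : length witnessSet ≤ c * k + n + 1
  size-bound = subst (_≤ c * k + n + 1) (sym length-witnessSet)
    (+-monoˡ-≤ 1 (+-monoˡ-≤ n (*-monoʳ-≤ c (≤-trans (length-deduplicate _≟_ VC) |VC|≤k))))
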